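{- Let $n\ge1$, $0\le k\le n$, let $d=\gcd(n,k)$, and put $n'=n/d$, $k'=k/d$. Then an optimal scheme for the $(n,k)$-problem defined by an $n\times m$ binary matrix exists if and only if $m=rn'$ for some integer $r\ge1$, in which case each traveller cycles exactly $l=rk'$ of the $m$ stages.
   Context: The $(n,k)$-problem: $n$ travellers share $k$ bicycles and must all reach the end of a route as soon as possible (minimising the time of the last arrival); all start together at time $0$, every traveller walks at the same speed $w$ and cycles at the same speed $v>w$, changing mode takes no time, bicycles start at the beginning of the route and move only when ridden by a single rider. For a positive integer $m$, the route is divided by posts $P_0,\dots,P_m$ into $m$ equal stages $s_1,\dots,s_m$; an $n\times m$ binary matrix $M=(m_{i,j})$ defines a scheme in which traveller $t_i$ cycles $s_j$ if $m_{i,j}=1$ and walks it otherwise, a traveller due to cycle $s_j$ having to take a bicycle present at $P_{j-1}$ when he arrives there. Such a scheme is optimal if every traveller cycles exactly the fraction $k/n$ of the route and the scheme can be executed with the $k$ bicycles without any traveller ever having to wait for a bicycle (so all travellers arrive simultaneously in the least possible time). -}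

module Defs where

open import Data.Bool using (Bool; true; false; _∧_; if_then_else_)
open import Data.Nat using (ℕ; zero; suc; _+_; _*_; _≤_; _<ᵇ_; _≤ᵇ_)
open import Data.Fin using (Fin; toℕ; inject₁)
open import Data.Product using (_×_)
open import Relation.Binary.PropositionalEquality using (_≡_)

cnt : ∀ {n} → (Fin n → Bool) → ℕ
cnt {zero}  f = 0
cnt {suc n} f = (if f Fin.zero then 1 else 0) + cnt (λ i → f (Fin.suc i))

-- A scheme: n × m binary matrix; M i j = true iff traveller i cycles stage j
-- (stages 0-indexed: stage j : Fin m is s_{j+1}, from post P_j to P_{j+1}).
Matrix : ℕ → ℕ → Set
Matrix n m = Fin n → Fin m → Bool

cycled : ∀ {n m} → Matrix n m → Fin n → ℕ
cycled M i = cnt (M i)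

-- number of stages traveller i has cycled before starting stage j
-- (i.e. on arrival at post P_j). Since all travellers reach P_j after j stages,
-- arrival time at P_j is j·a − c·(a − b) (a = walking time, b = cycling time
-- of a stage, a > b), so the arrival order at a post is exactly the
-- decreasing order of this count, independently of the speeds.
before : ∀ {n m} → Matrix n m → Fin n → Fin m → ℕ
before M i j = cnt (λ j' → (toℕ j' <ᵇ toℕ j) ∧ M i j')

-- Bicycles that have arrived at the start post of stage j by the time
-- threshold c (i.e. by the arrival time of a traveller with count c):
-- k bicycles at P_0; otherwise those ridden on the previous stage by
-- travellers whose count on arrival at that post is ≥ c.
supply : ∀ {n m} → ℕ → Matrix n m → Fin m → ℕ → ℕ
supply {m = suc m} k M Fin.zero    c = k
supply {m = suc m} k M (Fin.suc j) c =
  cnt (λ i → M i (inject₁ j) ∧ (c ≤ᵇ before M i (Fin.suc j)))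

-- No traveller ever waits for a bicycle: at every post, for every time,
-- the number of bicycles taken there up to that time does not exceed the
-- number of bicycles that have reached there up to that time.
NoWaiting : ∀ {n m} → ℕ → Matrix n m → Set
NoWaiting {n} {m} k M = ∀ (j : Fin m) (c : ℕ) →
  cnt (λ i → M i j ∧ (c ≤ᵇ before M i j)) ≤ supply k M j c

Optimal : ∀ n k m → Matrix n m → Set
Optimal n k m M = (∀ i → cycled M i * n ≡ k * m) × NoWaiting k M

-- Necessity: every traveller cycles l stages with l n = k m, i.e. l n′ = k′ m, and n′, k′ are
-- coprime, so n′ ∣ m. Sufficiency for m = r n′: let traveller i cycle stage j iff
-- (i + j) mod n′ < k′. Every row has r k′ ones, at most k′ d = k travellers start on a bicycle,
-- and at every later post the map i ↦ i + 1 (mod n, a symmetry of the scheme because n′ ∣ n)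
-- sends each traveller taking a bicycle there to one who brought a bicycle and arrived no later.
module Submission where

open import Defs
open import Data.Nat using (ℕ; _*_; _≤_)
open import Data.Nat.GCD using (gcd)
open import Data.Product using (Σ; ∃-syntax; _×_)
open import Function.Bundles using (_⇔_)
open import Relation.Binary.PropositionalEquality using (_≡_)

open import Data.Bool using (Bool; true; false; _∧_; if_then_else_)
open import Data.Bool.Properties using (T-≡)
open import Data.Nat using (zero; suc; _+_; _<ᵇ_; _≤ᵇ_; z≤n; s≤s; NonZero; >-nonZero; _%_)
open import Data.Nat.Properties
open import Data.Nat.Coprimality using (Coprime; gcd≡1⇒coprime; coprime-divisor)
open import Data.Nat.DivMod using ([m+n]%n≡m%n; m<n⇒m%n≡m)
open import Data.Nat.Divisibility using (_∣_; divides; m∣m*n)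
open import Data.Nat.GCD using (c*gcd[m,n]≡gcd[cm,cn])
open import Data.Nat.Tactic.RingSolver using (solve)
open import Data.List using (_∷_; [])
open import Data.Fin using (Fin; toℕ; fromℕ<)
open import Data.Fin.Properties using (toℕ-inject₁; toℕ<n)
open import Data.Product using (_,_)
open import Function using (_∘_)
open import Function.Bundles using (Equivalence; mk⇔)
open import Relation.Binary.PropositionalEquality
  using (refl; sym; trans; cong; cong₂; subst; module ≡-Reasoning)

[_] : Bool → ℕ
[ b ] = if b then 1 else 0

[b]≤1 : ∀ b → [ b ] ≤ 1
[b]≤1 true  = ≤-refl
[b]≤1 false = z≤n

[a∧b]≤[a] : ∀ a b → [ a ∧ b ] ≤ [ a ]
[a∧b]≤[a] true  b = [b]≤1 b
[a∧b]≤[a] false b = z≤n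

[≤ᵇ]-monoʳ : ∀ c {a b} → a ≤ b → [ c ≤ᵇ a ] ≤ [ c ≤ᵇ b ]
[≤ᵇ]-monoʳ c {a} {b} a≤b with c ≤ᵇ a in c≤ᵇa
... | false = z≤n
... | true  = ≤-reflexive (cong [_] (sym (Equivalence.to T-≡ (≤⇒≤ᵇ c≤b))))
  where
  c≤b : c ≤ b
  c≤b = ≤-trans (≤ᵇ⇒≤ c a (Equivalence.from T-≡ c≤ᵇa)) a≤b

cnt-cong : ∀ {n} {f g : Fin n → Bool} → (∀ i → f i ≡ g i) → cnt f ≡ cnt g
cnt-cong {zero}  f≡g = refl
cnt-cong {suc n} f≡g = cong₂ _+_ (cong [_] (f≡g Fin.zero)) (cnt-cong (f≡g ∘ Fin.suc))

cnt-mono : ∀ {n} {f g : Fin n → Bool} → (∀ i → [ f i ] ≤ [ g i ]) → cnt f ≤ cnt g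
cnt-mono {zero}  f≤g = z≤n
cnt-mono {suc n} f≤g = +-mono-≤ (f≤g Fin.zero) (cnt-mono (f≤g ∘ Fin.suc))

count : ℕ → (ℕ → Bool) → ℕ
count n h = cnt {n} (h ∘ toℕ)

count-cong : ∀ n {g h : ℕ → Bool} → (∀ t → g t ≡ h t) → count n g ≡ count n h
count-cong n g≡h = cnt-cong {n} (g≡h ∘ toℕ)

count-mono : ∀ n {g h : ℕ → Bool} → (∀ t → [ g t ] ≤ [ h t ]) → count n g ≤ count n h
count-mono n g≤h = cnt-mono {n} (g≤h ∘ toℕ)

count-false : ∀ n → count n (λ _ → false) ≡ 0
count-false zero    = refl
count-false (suc n) = count-false n

count-<ᵇ : ∀ n {J} → J ≤ n → count n (_<ᵇ J) ≡ J
count-<ᵇ zero    z≤n     = refl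
count-<ᵇ (suc n) {zero}  _ = count-false n
count-<ᵇ (suc n) {suc J} (s≤s J≤n) = cong suc (count-<ᵇ n J≤n)

count-<ᵇ-∧ : ∀ n {J} (h : ℕ → Bool) → J ≤ n → count n (λ t → (t <ᵇ J) ∧ h t) ≡ count J h
count-<ᵇ-∧ zero    h z≤n     = refl
count-<ᵇ-∧ (suc n) {zero}  h _ = count-false n
count-<ᵇ-∧ (suc n) {suc J} h (s≤s J≤n) = cong ([ h 0 ] +_) (count-<ᵇ-∧ n (h ∘ suc) J≤n)

count-+ : ∀ a b h → count (a + b) h ≡ count a h + count b (λ t → h (a + t))
count-+ zero    b h = refl
count-+ (suc a) b h =
  trans (cong ([ h 0 ] +_) (count-+ a b (h ∘ suc))) (sym (+-assoc [ h 0 ] _ _))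

count-suc : ∀ n h → count (suc n) h ≡ count n h + [ h n ]
count-suc zero    h = +-comm [ h 0 ] 0
count-suc (suc n) h =
  trans (cong ([ h 0 ] +_) (count-suc n (h ∘ suc))) (sym (+-assoc [ h 0 ] _ _))

count-telescope : ∀ n h → count n (h ∘ suc) + [ h 0 ] ≡ count n h + [ h n ]
count-telescope n h = trans (+-comm (count n (h ∘ suc)) [ h 0 ]) (count-suc n h)

Periodic : ℕ → (ℕ → Bool) → Set
Periodic p h = ∀ t → h (t + p) ≡ h t

shift : ℕ → (ℕ → Bool) → ℕ → Bool
shift I h t = h (I + t)

shift-periodic : ∀ {p h} I → Periodic p h → Periodic p (shift I h)
shift-periodic {p} {h} I per t = trans (cong h (sym (+-assoc I t p))) (per (I + t))

periodic-∣ : ∀ {p q h} → p ∣ q → Periodic p h → Periodic q h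
periodic-∣ {p} {h = h} (divides d refl) per = multiple d
  where
  multiple : ∀ d → Periodic (d * p) h
  multiple zero    t = cong h (+-identityʳ t)
  multiple (suc d) t =
    trans (cong h (sym (+-assoc t p (d * p)))) (trans (multiple d (t + p)) (per t))

periodic-+ : ∀ {p h} → Periodic p h → ∀ I t → h (I + p + t) ≡ h (I + t)
periodic-+ {p} {h} per I t = begin
  h (I + p + t)   ≡⟨ cong h (+-assoc I p t) ⟩
  h (I + (p + t)) ≡⟨ cong (h ∘ (I +_)) (+-comm p t) ⟩
  h (I + (t + p)) ≡⟨ shift-periodic I per t ⟩
  h (I + t)       ∎
  where open ≡-Reasoning

count-rotate : ∀ n {h} → Periodic n h → count n (h ∘ suc) ≡ count n h
count-rotate n {h} per =
  +-cancelʳ-≡ [ h 0 ] _ _ (trans (count-telescope n h) (cong (λ b → count n h + [ b ]) (per 0)))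

count-shift : ∀ p {h} → Periodic p h → ∀ I → count p (shift I h) ≡ count p h
count-shift p per zero    = refl
count-shift p per (suc I) = trans (count-shift p (per ∘ suc) I) (count-rotate p per)

count-* : ∀ d p {h} → Periodic p h → count (d * p) h ≡ d * count p h
count-* zero    p per = refl
count-* (suc d) p {h} per = begin
  count (p + d * p) h                  ≡⟨ count-+ p (d * p) h ⟩
  count p h + count (d * p) (shift p h) ≡⟨ cong (count p h +_) (count-cong (d * p) shift-p≗h) ⟩
  count p h + count (d * p) h          ≡⟨ cong (count p h +_) (count-* d p per) ⟩
  count p h + d * count p h            ∎
  where
  open ≡-Reasoning
  shift-p≗h : ∀ t → shift p h t ≡ h t
  shift-p≗h t = trans (cong h (+-comm p t)) (per t)

count-shift-suc : ∀ L h I → count L (shift (suc I) h) + [ h I ] ≡ count L (shift I h) + [ h (I + L) ]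
count-shift-suc L h I = begin
  count L (shift (suc I) h) + [ h I ]           ≡⟨ cong₂ _+_ shift-suc (cong ([_] ∘ h) (sym (+-identityʳ I))) ⟩
  count L (shift I h ∘ suc) + [ shift I h 0 ]   ≡⟨ count-telescope L (shift I h) ⟩
  count L (shift I h) + [ h (I + L) ]           ∎
  where
  open ≡-Reasoning
  shift-suc : count L (shift (suc I) h) ≡ count L (shift I h ∘ suc)
  shift-suc = count-cong L (λ t → cong h (sym (+-suc I t)))

count-shift-mono : ∀ L h I → h (I + L) ≡ true → count L (shift I h) ≤ count L (shift (suc I) h)
count-shift-mono L h I hIL = +-cancelʳ-≤ 1 _ _ (begin
  count L (shift I h) + 1                 ≡⟨ cong (λ b → count L (shift I h) + [ b ]) (sym hIL) ⟩
  count L (shift I h) + [ h (I + L) ]     ≡⟨ sym (count-shift-suc L h I) ⟩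
  count L (shift (suc I) h) + [ h I ]     ≤⟨ +-monoʳ-≤ (count L (shift (suc I) h)) ([b]≤1 (h I)) ⟩
  count L (shift (suc I) h) + 1           ∎)
  where open ≤-Reasoning

cyclic : ∀ {n m} → (ℕ → Bool) → Matrix n m
cyclic f i j = f (toℕ i + toℕ j)

before-cyclic : ∀ {n m} f (i : Fin n) (j : Fin m) →
  before (cyclic f) i j ≡ count (toℕ j) (shift (toℕ i) f)
before-cyclic {m = m} f i j = count-<ᵇ-∧ m (shift (toℕ i) f) (<⇒≤ (toℕ<n j))

cycled-cyclic : ∀ {n} r p {f} → Periodic p f → (i : Fin n) →
  cycled {m = r * p} (cyclic f) i ≡ r * count p f
cycled-cyclic r p {f} per i = begin
  count (r * p) (shift (toℕ i) f)   ≡⟨ count-* r p (shift-periodic (toℕ i) per) ⟩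
  r * count p (shift (toℕ i) f)     ≡⟨ cong (r *_) (count-shift p per (toℕ i)) ⟩
  r * count p f                     ∎
  where open ≡-Reasoning

module CyclicScheme {n} {f : ℕ → Bool} (per : Periodic n f) where

  ridesWith : ℕ → ℕ → ℕ → ℕ → Bool
  ridesWith c L J I = f (I + J) ∧ (c ≤ᵇ count L (shift I f))

  ridesWith-periodic : ∀ c L J → Periodic n (ridesWith c L J)
  ridesWith-periodic c L J I =
    cong₂ _∧_ (periodic-+ per I J) (cong (c ≤ᵇ_) (count-cong L (periodic-+ per I)))

  -- Traveller I taking a bicycle at post J + 1 is matched with traveller I + 1, who rode stage J
  -- and, having cycled at least as much, reached post J + 1 no later.
  rider-preceded : ∀ c J I → [ ridesWith c (suc J) (suc J) I ] ≤ [ ridesWith c (suc J) J (suc I) ]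
  rider-preceded c J I with f (I + suc J) in fIJ
  ... | false = z≤n
  ... | true rewrite sym (+-suc I J) | fIJ = [≤ᵇ]-monoʳ c (count-shift-mono (suc J) f I fIJ)

  noWaiting : ∀ {m k} → count n f ≤ k → NoWaiting {n} {m} k (cyclic f)
  noWaiting {suc m} {k} fn≤k Fin.zero c = begin
    cnt (λ i → M i Fin.zero ∧ (c ≤ᵇ before M i Fin.zero))
      ≤⟨ cnt-mono {n} (λ i → [a∧b]≤[a] (M i Fin.zero) _) ⟩
    count n (λ t → f (t + 0))
      ≡⟨ count-cong n (λ t → cong f (+-identityʳ t)) ⟩
    count n f
      ≤⟨ fn≤k ⟩
    k ∎
    where
    open ≤-Reasoning
    M = cyclic {n} {suc m} f
  noWaiting {suc m} {k} fn≤k (Fin.suc j) c = begin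
    cnt (λ i → M i (Fin.suc j) ∧ (c ≤ᵇ before M i (Fin.suc j)))
      ≡⟨ cnt-cong {n} (λ i → cong (λ x → M i (Fin.suc j) ∧ (c ≤ᵇ x)) (before-cyclic f i (Fin.suc j))) ⟩
    count n (ridesWith c (suc J) (suc J))
      ≤⟨ count-mono n (rider-preceded c J) ⟩
    count n (ridesWith c (suc J) J ∘ suc)
      ≡⟨ count-rotate n (ridesWith-periodic c (suc J) J) ⟩
    count n (ridesWith c (suc J) J)
      ≡⟨ cnt-cong {n} (λ i → cong₂ (λ x y → f (toℕ i + x) ∧ (c ≤ᵇ y))
                        (sym (toℕ-inject₁ j)) (sym (before-cyclic f i (Fin.suc j)))) ⟩
    supply k M (Fin.suc j) c ∎
    where
    open ≤-Reasoning
    M = cyclic {n} {suc m} f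
    J = toℕ j

cyclingPattern : (n′ k′ : ℕ) → .{{NonZero n′}} → ℕ → Bool
cyclingPattern n′ k′ t = t % n′ <ᵇ k′

module _ {n′ k′ : ℕ} .{{_ : NonZero n′}} where

  cyclingPattern-periodic : Periodic n′ (cyclingPattern n′ k′)
  cyclingPattern-periodic t = cong (_<ᵇ k′) ([m+n]%n≡m%n t n′)

  count-cyclingPattern : k′ ≤ n′ → count n′ (cyclingPattern n′ k′) ≡ k′
  count-cyclingPattern k′≤n′ =
    trans (cnt-cong (λ i → cong (_<ᵇ k′) (m<n⇒m%n≡m (toℕ<n i)))) (count-<ᵇ n′ k′≤n′)

  cyclingPattern-optimal : ∀ d r → k′ ≤ n′ →
    Optimal (n′ * d) (k′ * d) (r * n′) (cyclic (cyclingPattern n′ k′))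
  cyclingPattern-optimal d r k′≤n′ =
    fraction , CyclicScheme.noWaiting per (≤-reflexive count-period)
    where
    open ≡-Reasoning
    M = cyclic {n′ * d} {r * n′} (cyclingPattern n′ k′)

    per : Periodic (n′ * d) (cyclingPattern n′ k′)
    per = periodic-∣ (m∣m*n d) cyclingPattern-periodic

    count-period : count (n′ * d) (cyclingPattern n′ k′) ≡ k′ * d
    count-period = begin
      count (n′ * d) (cyclingPattern n′ k′) ≡⟨ cong (λ p → count p (cyclingPattern n′ k′)) (*-comm n′ d) ⟩
      count (d * n′) (cyclingPattern n′ k′) ≡⟨ count-* d n′ cyclingPattern-periodic ⟩
      d * count n′ (cyclingPattern n′ k′)   ≡⟨ cong (d *_) (count-cyclingPattern k′≤n′) ⟩
      d * k′                                ≡⟨ *-comm d k′ ⟩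
      k′ * d                                ∎

    fraction : ∀ i → cycled M i * (n′ * d) ≡ k′ * d * (r * n′)
    fraction i = begin
      cycled M i * (n′ * d)
        ≡⟨ cong (_* (n′ * d)) (cycled-cyclic r n′ cyclingPattern-periodic i) ⟩
      r * count n′ (cyclingPattern n′ k′) * (n′ * d)
        ≡⟨ cong (λ l → r * l * (n′ * d)) (count-cyclingPattern k′≤n′) ⟩
      r * k′ * (n′ * d)
        ≡⟨ solve (r ∷ k′ ∷ n′ ∷ d ∷ []) ⟩
      k′ * d * (r * n′) ∎

quotients-coprime : ∀ n′ k′ d .{{_ : NonZero d}} → gcd (n′ * d) (k′ * d) ≡ d → Coprime n′ k′
quotients-coprime n′ k′ d gcd≡d = gcd≡1⇒coprime (*-cancelˡ-≡ (gcd n′ k′) 1 d (begin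
  d * gcd n′ k′          ≡⟨ c*gcd[m,n]≡gcd[cm,cn] d n′ k′ ⟩
  gcd (d * n′) (d * k′)  ≡⟨ cong₂ gcd (*-comm d n′) (*-comm d k′) ⟩
  gcd (n′ * d) (k′ * d)  ≡⟨ gcd≡d ⟩
  d                      ≡⟨ sym (*-identityʳ d) ⟩
  d * 1                  ∎))
  where open ≡-Reasoning

*-cancel-common : ∀ l m n′ k′ d .{{_ : NonZero d}} → l * (n′ * d) ≡ k′ * d * m → l * n′ ≡ k′ * m
*-cancel-common l m n′ k′ d eq = *-cancelʳ-≡ (l * n′) (k′ * m) d (begin
  l * n′ * d    ≡⟨ *-assoc l n′ d ⟩
  l * (n′ * d)  ≡⟨ eq ⟩
  k′ * d * m    ≡⟨ solve (k′ ∷ d ∷ m ∷ []) ⟩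
  k′ * m * d    ∎)
  where open ≡-Reasoning

multiple-of : ∀ {m n′ k′} l → Coprime n′ k′ → 1 ≤ m → l * n′ ≡ k′ * m → ∃[ r ] (1 ≤ r × m ≡ r * n′)
multiple-of {m = suc _} l coprime _ eq with coprime-divisor coprime (divides l (sym eq))
... | divides zero    ()
... | divides (suc r) m≡rn′ = suc r , s≤s z≤n , m≡rn′

*-cancelʳ-multiple : ∀ l r n′ k′ .{{_ : NonZero n′}} → l * n′ ≡ k′ * (r * n′) → l ≡ r * k′
*-cancelʳ-multiple l r n′ k′ eq = *-cancelʳ-≡ l (r * k′) n′ (trans eq (solve (k′ ∷ r ∷ n′ ∷ [])))

theorem6p4 : ∀ (n k m d n′ k′ : ℕ) → 1 ≤ n → k ≤ n → 1 ≤ m →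
    gcd n k ≡ d → n ≡ n′ * d → k ≡ k′ * d →
    ((Σ (Matrix n m) (Optimal n k m)) ⇔ (∃[ r ] (1 ≤ r × m ≡ r * n′)))
    × (∀ (M : Matrix n m) → Optimal n k m M →
         ∀ r → m ≡ r * n′ → ∀ i → cycled M i ≡ r * k′)
theorem6p4 .(n′ * d) .(k′ * d) m d n′ k′ 1≤n k≤n 1≤m gcd≡d refl refl =
  mk⇔ (λ (M , fraction , _) → multiple-of (cycled M i₀) (quotients-coprime n′ k′ d gcd≡d) 1≤m
                                 (*-cancel-common (cycled M i₀) m n′ k′ d (fraction i₀)))
      (λ (r , _ , m≡rn′) → subst (λ m → Σ (Matrix (n′ * d) m) (Optimal (n′ * d) (k′ * d) m))
                              (sym m≡rn′) (_ , cyclingPattern-optimal d r k′≤n′))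
  , λ M (fraction , _) r m≡rn′ i → *-cancelʳ-multiple (cycled M i) r n′ k′
      (*-cancel-common (cycled M i) (r * n′) n′ k′ d (trans (fraction i) (cong (k′ * d *_) m≡rn′)))
  where
  instance
    n′≢0 : NonZero n′
    n′≢0 = m*n≢0⇒m≢0 n′ {{>-nonZero 1≤n}}
    d≢0 : NonZero d
    d≢0 = m*n≢0⇒n≢0 n′ {{>-nonZero 1≤n}}

  k′≤n′ : k′ ≤ n′
  k′≤n′ = *-cancelʳ-≤ k′ n′ d k≤n

  i₀ : Fin (n′ * d)
  i₀ = fromℕ< 1≤n
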